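{- Let $\mathcal{X}_1,\mathcal{X}_2,\mathcal{X}_3,\mathcal{X}_4$ be D-posets and let $f_1:\mathcal{X}_1\to\mathcal{X}_3$ and $f_2:\mathcal{X}_2\to\mathcal{X}_4$ be generalized D-monotonic functions. Then for all $i,j\in\{1,2,3,4\}$ there is an isomorphism of categories $\mathbb{B}(\mathcal{X}_i\times\mathcal{X}_j)\cong(\mathbb{B}\mathcal{X}_i)\times(\mathbb{B}\mathcal{X}_j)$ which is the identity on objects (the set $X_i\times X_j$), and under these isomorphisms $\mathbb{B}(f_1\times f_2)$ coincides with $(\mathbb{B}f_1)\times(\mathbb{B}f_2):\mathbb{B}(\mathcal{X}_1\times\mathcal{X}_2)\to\mathbb{B}(\mathcal{X}_3\times\mathcal{X}_4)$.
   Context: A D-poset $(X,\leq,\top,\ominus)$ is a poset with top element $\top$ and a partial binary operation $\ominus$ such that: (1) $y\ominus x$ is defined precisely when $x\leq y$; (2) whenever $x\leq y$, $y\ominus x\leq y$ and $y\ominus(y\ominus x)=x$; (3) if $z\leq y\leq x$ then $x\ominus y\leq x\ominus z$ and $(x\ominus z)\ominus(x\ominus y)=y\ominus z$. Its bottom is $\bot:=x\ominus x$ and its canonical sum is: $a\oplus b$ defined iff there is $c$ with $c\ominus b=a$, then $a\oplus b:=c$. The product of D-posets $(X,\leq,\top,\ominus)$ and $(Y,\preceq,\uparrow,\boxminus)$ is $X\times Y$ with componentwise order, top $(\top,\uparrow)$ and componentwise difference. A generalized D-monotonic function is a monotone map $f$ with $f(y\ominus x)=f(y)\ominus' f(x)$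 whenever $x\leq y$. For a D-poset $\mathcal{X}$, $\mathbb{B}\mathcal{X}$ is the category with objects the elements of $X$, hom-sets $\mathbb{B}\mathcal{X}[x,y]=\{x\}\times\{t:t\leq y\ominus x\}\times\{y\}$ if $x\leq y$ and $\emptyset$ otherwise, identities $(x,\bot,x)$, composition $(y,\phi,z)\circ(x,\psi,y)=(x,\phi\oplus\psi,z)$; for a generalized D-monotonic $f$, $\mathbb{B}f$ is the functor $x\mapsto f(x)$, $(x,\phi,y)\mapsto(f(x),f(\phi),f(y))$. -}

module Defs where

open import Level using (Level; _⊔_) renaming (suc to lsuc)
open import Data.Product using (Σ; _×_; _,_; proj₁; proj₂)
open import Relation.Binary.PropositionalEquality
  using (_≡_; refl; sym; trans; cong; cong₂; subst; isEquivalence)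
open import Relation.Binary.Structures using (IsPartialOrder; IsPreorder)

-- The partial difference  y ⊖ x  (defined precisely when x ≤ y) is
-- modelled as a total operation whose values outside the domain
-- {(y , x) | x ≤ y} are irrelevant: every axiom only speaks about
-- y ⊖ x under the hypothesis x ≤ y.

record DPoset (c ℓ : Level) : Set (lsuc (c ⊔ ℓ)) where
  infix 4 _≤_
  infixl 6 _⊖_
  field
    Carrier        : Set c
    _≤_            : Carrier → Carrier → Set ℓ
    isPartialOrder : IsPartialOrder _≡_ _≤_
    ⊤              : Carrier
    ≤-⊤            : ∀ x → x ≤ ⊤
    _⊖_            : Carrier → Carrier → Carrier
    ⊖-≤            : ∀ {x y} → x ≤ y → y ⊖ x ≤ y
    ⊖-invol        : ∀ {x y} → x ≤ y → y ⊖ (y ⊖ x) ≡ x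
    ⊖-antitone     : ∀ {x y z} → z ≤ y → y ≤ x → x ⊖ y ≤ x ⊖ z
    ⊖-⊖            : ∀ {x y z} → z ≤ y → y ≤ x → (x ⊖ z) ⊖ (x ⊖ y) ≡ y ⊖ z

  open IsPartialOrder isPartialOrder public
    using (antisym) renaming (refl to ≤-refl; trans to ≤-trans)

  -- bottom  ⊥ := x ⊖ x  (for any x)
  ⊥ : Carrier
  ⊥ = ⊤ ⊖ ⊤

  -- "a ⊕ b is defined with value s": there is s with s ⊖ b = a
  -- (s ⊖ b being defined means b ≤ s).
  IsSum : Carrier → Carrier → Carrier → Set (c ⊔ ℓ)
  IsSum a b s = (b ≤ s) × (s ⊖ b ≡ a)

  -- The canonical sum.  Whenever a ⊕ b is defined (IsSum a b s for
  -- some s) its value s is forced to be the following element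
  -- (lemma sum-unique below), so this is the paper's a ⊕ b.
  _⊕_ : Carrier → Carrier → Carrier
  a ⊕ b = ⊤ ⊖ ((⊤ ⊖ b) ⊖ a)

  sum-unique : ∀ {a b s} → IsSum a b s → s ≡ a ⊕ b
  sum-unique {a} {b} {s} (b≤s , eq) =
    trans (sym (⊖-invol (≤-⊤ s))) (cong (⊤ ⊖_) (sym e2))
    where
    e1 : (⊤ ⊖ b) ⊖ (⊤ ⊖ s) ≡ a
    e1 = trans (⊖-⊖ b≤s (≤-⊤ s)) eq
    l1 : ⊤ ⊖ s ≤ ⊤ ⊖ b
    l1 = ⊖-antitone b≤s (≤-⊤ s)
    e2 : (⊤ ⊖ b) ⊖ a ≡ ⊤ ⊖ s
    e2 = trans (cong ((⊤ ⊖ b) ⊖_) (sym e1)) (⊖-invol l1)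

  -- composition in 𝔹X is well defined:  for x ≤ y ≤ z, ψ ≤ y ⊖ x,
  -- φ ≤ z ⊖ y, the sum φ ⊕ ψ is defined and φ ⊕ ψ ≤ z ⊖ x.
  comp-lemma : ∀ {x y z φ ψ} → x ≤ y → y ≤ z → ψ ≤ y ⊖ x → φ ≤ z ⊖ y →
               IsSum φ ψ (φ ⊕ ψ) × (φ ⊕ ψ ≤ z ⊖ x)
  comp-lemma {x} {y} {z} {φ} {ψ} x≤y y≤z ψ≤A φ≤B =
    subst (IsSum φ ψ) s≡ sumc , subst (_≤ D) s≡ c≤D
    where
    D = z ⊖ x
    B = z ⊖ y
    B≤D : B ≤ D
    B≤D = ⊖-antitone x≤y y≤z
    DB : D ⊖ B ≡ y ⊖ x
    DB = ⊖-⊖ x≤y y≤z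
    φ≤D : φ ≤ D
    φ≤D = ≤-trans φ≤B B≤D
    g = D ⊖ φ
    A≤g : y ⊖ x ≤ g
    A≤g = subst (_≤ g) DB (⊖-antitone φ≤B B≤D)
    ψ≤g : ψ ≤ g
    ψ≤g = ≤-trans ψ≤A A≤g
    g≤D : g ≤ D
    g≤D = ⊖-≤ φ≤D
    φ≤Dψ : φ ≤ D ⊖ ψ
    φ≤Dψ = subst (_≤ D ⊖ ψ) (⊖-invol φ≤D) (⊖-antitone ψ≤g g≤D)
    ψ≤D : ψ ≤ D
    ψ≤D = ≤-trans ψ≤g g≤D
    Dψ≤D : D ⊖ ψ ≤ D
    Dψ≤D = ⊖-≤ ψ≤D
    e = (D ⊖ ψ) ⊖ φ
    e≤Dψ : e ≤ D ⊖ ψ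
    e≤Dψ = ⊖-≤ φ≤Dψ
    cc = D ⊖ e
    ψ≤c : ψ ≤ cc
    ψ≤c = subst (_≤ cc) (⊖-invol ψ≤D) (⊖-antitone e≤Dψ Dψ≤D)
    cψ : cc ⊖ ψ ≡ φ
    cψ = trans (subst (λ w → cc ⊖ w ≡ (D ⊖ ψ) ⊖ e) (⊖-invol ψ≤D)
                      (⊖-⊖ e≤Dψ Dψ≤D))
               (⊖-invol φ≤Dψ)
    sumc : IsSum φ ψ cc
    sumc = ψ≤c , cψ
    s≡ : cc ≡ φ ⊕ ψ
    s≡ = sum-unique sumc
    c≤D : cc ≤ D
    c≤D = ⊖-≤ (≤-trans e≤Dψ Dψ≤D)

module _ {c ℓ : Level} (X Y : DPoset c ℓ) where
  private
    module X = DPoset X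
    module Y = DPoset Y

  _×D_ : DPoset c ℓ
  _×D_ = record
    { Carrier        = X.Carrier × Y.Carrier
    ; _≤_            = λ p q → (proj₁ p X.≤ proj₁ q) × (proj₂ p Y.≤ proj₂ q)
    ; isPartialOrder = record
      { isPreorder = record
        { isEquivalence = isEquivalence
        ; reflexive     = λ { refl → X.≤-refl , Y.≤-refl }
        ; trans         = λ p q → X.≤-trans (proj₁ p) (proj₁ q)
                                 , Y.≤-trans (proj₂ p) (proj₂ q)
        }
      ; antisym = λ p q → cong₂ _,_ (X.antisym (proj₁ p) (proj₁ q))
                                    (Y.antisym (proj₂ p) (proj₂ q))
      }
    ; ⊤              = X.⊤ , Y.⊤
    ; ≤-⊤            = λ p → X.≤-⊤ (proj₁ p) , Y.≤-⊤ (proj₂ p)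
    ; _⊖_            = λ q p → (proj₁ q X.⊖ proj₁ p) , (proj₂ q Y.⊖ proj₂ p)
    ; ⊖-≤            = λ p → X.⊖-≤ (proj₁ p) , Y.⊖-≤ (proj₂ p)
    ; ⊖-invol        = λ p → cong₂ _,_ (X.⊖-invol (proj₁ p)) (Y.⊖-invol (proj₂ p))
    ; ⊖-antitone     = λ p q → X.⊖-antitone (proj₁ p) (proj₁ q)
                              , Y.⊖-antitone (proj₂ p) (proj₂ q)
    ; ⊖-⊖            = λ p q → cong₂ _,_ (X.⊖-⊖ (proj₁ p) (proj₁ q))
                                         (Y.⊖-⊖ (proj₂ p) (proj₂ q))
    }

record DMono {c ℓ c' ℓ' : Level} (X : DPoset c ℓ) (Y : DPoset c' ℓ')
       : Set (c ⊔ ℓ ⊔ c' ⊔ ℓ') where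
  private
    module X = DPoset X
    module Y = DPoset Y
  field
    map      : X.Carrier → Y.Carrier
    monotone : ∀ {x y} → x X.≤ y → map x Y.≤ map y
    pres-⊖   : ∀ {x y} → x X.≤ y → map (y X.⊖ x) ≡ map y Y.⊖ map x

_×M_ : ∀ {c ℓ} {X₁ X₂ X₃ X₄ : DPoset c ℓ} →
       DMono X₁ X₃ → DMono X₂ X₄ → DMono (X₁ ×D X₂) (X₃ ×D X₄)
f ×M g = record
  { map      = λ p → DMono.map f (proj₁ p) , DMono.map g (proj₂ p)
  ; monotone = λ p → DMono.monotone f (proj₁ p) , DMono.monotone g (proj₂ p)
  ; pres-⊖   = λ p → cong₂ _,_ (DMono.pres-⊖ f (proj₁ p)) (DMono.pres-⊖ g (proj₂ p))
  }

record CatOn {o : Level} (Ob : Set o) (h e : Level) : Set (o ⊔ lsuc (h ⊔ e)) where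
  infixr 9 _∘_
  infix 4 _≈_
  field
    Hom : Ob → Ob → Set h
    _≈_ : ∀ {a b} → Hom a b → Hom a b → Set e
    id  : ∀ {a} → Hom a a
    _∘_ : ∀ {a b d} → Hom b d → Hom a b → Hom a d

open CatOn public using (Hom)

record Functor {o₁ h₁ e₁ o₂ h₂ e₂} {O₁ : Set o₁} {O₂ : Set o₂}
       (C : CatOn O₁ h₁ e₁) (D : CatOn O₂ h₂ e₂)
       : Set (o₁ ⊔ h₁ ⊔ e₁ ⊔ o₂ ⊔ h₂ ⊔ e₂) where
  private
    module C = CatOn C
    module D = CatOn D
  field
    F₀     : O₁ → O₂
    F₁     : ∀ {a b} → C.Hom a b → D.Hom (F₀ a) (F₀ b)
    F-resp : ∀ {a b} {f g : C.Hom a b} → f C.≈ g → F₁ f D.≈ F₁ g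
    F-id   : ∀ {a} → F₁ (C.id {a}) D.≈ D.id
    F-∘    : ∀ {a b d} (g : C.Hom b d) (f : C.Hom a b) →
             F₁ (g C.∘ f) D.≈ F₁ g D.∘ F₁ f

record IdObFunctor {o h₁ e₁ h₂ e₂} {O : Set o}
       (C : CatOn O h₁ e₁) (D : CatOn O h₂ e₂)
       : Set (o ⊔ h₁ ⊔ e₁ ⊔ h₂ ⊔ e₂) where
  private
    module C = CatOn C
    module D = CatOn D
  field
    F₁     : ∀ {a b} → C.Hom a b → D.Hom a b
    F-resp : ∀ {a b} {f g : C.Hom a b} → f C.≈ g → F₁ f D.≈ F₁ g
    F-id   : ∀ {a} → F₁ (C.id {a}) D.≈ D.id
    F-∘    : ∀ {a b d} (g : C.Hom b d) (f : C.Hom a b) →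
             F₁ (g C.∘ f) D.≈ F₁ g D.∘ F₁ f

record IdObIso {o h₁ e₁ h₂ e₂} {O : Set o}
       (C : CatOn O h₁ e₁) (D : CatOn O h₂ e₂)
       : Set (o ⊔ h₁ ⊔ e₁ ⊔ h₂ ⊔ e₂) where
  private
    module C = CatOn C
    module D = CatOn D
  field
    to      : IdObFunctor C D
    from    : IdObFunctor D C
  open IdObFunctor
  field
    from∘to : ∀ {a b} (f : C.Hom a b) → F₁ from (F₁ to f) C.≈ f
    to∘from : ∀ {a b} (g : D.Hom a b) → F₁ to (F₁ from g) D.≈ g

_×C_ : ∀ {o h e} {O₁ O₂ : Set o} → CatOn O₁ h e → CatOn O₂ h e →
       CatOn (O₁ × O₂) h e
C ×C D = record
  { Hom = λ p q → CatOn.Hom C (proj₁ p) (proj₁ q) × CatOn.Hom D (proj₂ p) (proj₂ q)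
  ; _≈_ = λ f g → CatOn._≈_ C (proj₁ f) (proj₁ g) × CatOn._≈_ D (proj₂ f) (proj₂ g)
  ; id  = CatOn.id C , CatOn.id D
  ; _∘_ = λ g f → CatOn._∘_ C (proj₁ g) (proj₁ f) , CatOn._∘_ D (proj₂ g) (proj₂ f)
  }

_×F_ : ∀ {o h e} {O₁ O₂ O₃ O₄ : Set o}
         {C₁ : CatOn O₁ h e} {C₂ : CatOn O₂ h e}
         {C₃ : CatOn O₃ h e} {C₄ : CatOn O₄ h e} →
       Functor C₁ C₃ → Functor C₂ C₄ → Functor (C₁ ×C C₂) (C₃ ×C C₄)
F ×F G = record
  { F₀     = λ p → Functor.F₀ F (proj₁ p) , Functor.F₀ G (proj₂ p)
  ; F₁     = λ f → Functor.F₁ F (proj₁ f) , Functor.F₁ G (proj₂ f)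
  ; F-resp = λ e → Functor.F-resp F (proj₁ e) , Functor.F-resp G (proj₂ e)
  ; F-id   = Functor.F-id F , Functor.F-id G
  ; F-∘    = λ g f → Functor.F-∘ F (proj₁ g) (proj₁ f) , Functor.F-∘ G (proj₂ g) (proj₂ f)
  }

-- The category 𝔹X.
-- 𝔹X[x,y] = {x} × {t | t ≤ y ⊖ x} × {y}  if x ≤ y, empty otherwise.
-- A morphism x → y is represented by a proof of x ≤ y together with
-- t and a proof of t ≤ y ⊖ x; two morphisms are equal iff their
-- middle components t coincide (the proofs carry no information).
-- id = (x , x ⊖ x , x) = (x , ⊥ , x);  (y,φ,z) ∘ (x,ψ,y) = (x , φ ⊕ ψ , z).

𝔹 : ∀ {c ℓ} (X : DPoset c ℓ) → CatOn (DPoset.Carrier X) (c ⊔ ℓ) c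
𝔹 X = record
  { Hom = λ x y → Σ (x ≤ y) λ _ → Σ Carrier λ t → t ≤ y ⊖ x
  ; _≈_ = λ f g → proj₁ (proj₂ f) ≡ proj₁ (proj₂ g)
  ; id  = λ {x} → ≤-refl , x ⊖ x , ≤-refl
  ; _∘_ = λ { (y≤z , φ , φ≤) (x≤y , ψ , ψ≤) →
              ≤-trans x≤y y≤z , φ ⊕ ψ , proj₂ (comp-lemma x≤y y≤z ψ≤ φ≤) }
  }
  where open DPoset X

𝔹₁ : ∀ {c ℓ} {X Y : DPoset c ℓ} → DMono X Y → Functor (𝔹 X) (𝔹 Y)
𝔹₁ {X = X} {Y} f = record
  { F₀     = map
  ; F₁     = λ { (x≤y , φ , φ≤) →
                 monotone x≤y , map φ , subst (map φ Y.≤_) (pres-⊖ x≤y) (monotone φ≤) }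
  ; F-resp = cong map
  ; F-id   = λ {x} → pres-⊖ X.≤-refl
  ; F-∘    = λ { (y≤z , φ , φ≤) (x≤y , ψ , ψ≤) → F∘ x≤y y≤z ψ≤ φ≤ }
  }
  where
  module X = DPoset X
  module Y = DPoset Y
  open DMono f
  F∘ : ∀ {x y z φ ψ} → x X.≤ y → y X.≤ z → ψ X.≤ y X.⊖ x → φ X.≤ z X.⊖ y →
       map (φ X.⊕ ψ) ≡ map φ Y.⊕ map ψ
  F∘ x≤y y≤z ψ≤ φ≤ with proj₁ (X.comp-lemma x≤y y≤z ψ≤ φ≤)
  ... | (ψ≤s , sψ) =
    Y.sum-unique (monotone ψ≤s , trans (sym (pres-⊖ ψ≤s)) (cong map sψ))

-- "Under the identity-on-objects isomorphisms Φ₁₂ : 𝔹(X₁×X₂) ≅ 𝔹X₁×𝔹X₂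
-- and Φ₃₄ : 𝔹(X₃×X₄) ≅ 𝔹X₃×𝔹X₄, 𝔹(f₁×f₂) coincides with 𝔹f₁×𝔹f₂":
-- Φ₃₄ ∘ 𝔹(f₁×f₂) = (𝔹f₁×𝔹f₂) ∘ Φ₁₂ as functors.  On objects both
-- composites are (a₁ , a₂) ↦ (f₁ a₁ , f₂ a₂) definitionally; on
-- morphisms we require equality in 𝔹X₃×𝔹X₄.

Coincide : ∀ {c ℓ} {X₁ X₂ X₃ X₄ : DPoset c ℓ}
           (f₁ : DMono X₁ X₃) (f₂ : DMono X₂ X₄) →
           IdObIso (𝔹 (X₁ ×D X₂)) (𝔹 X₁ ×C 𝔹 X₂) →
           IdObIso (𝔹 (X₃ ×D X₄)) (𝔹 X₃ ×C 𝔹 X₄) → Set (c ⊔ ℓ)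
Coincide {X₁ = X₁} {X₂} {X₃} {X₄} f₁ f₂ Φ₁₂ Φ₃₄ =
  ∀ {a b} (h : Hom (𝔹 (X₁ ×D X₂)) a b) →
    CatOn._≈_ (𝔹 X₃ ×C 𝔹 X₄)
      (IdObFunctor.F₁ (IdObIso.to Φ₃₄) (Functor.F₁ (𝔹₁ (f₁ ×M f₂)) h))
      (Functor.F₁ (𝔹₁ f₁ ×F 𝔹₁ f₂) (IdObFunctor.F₁ (IdObIso.to Φ₁₂) h))

module Submission where

open import Defs
open import Data.Fin using (Fin)
open import Data.Product using (Σ; _,_; proj₁; proj₂)
open import Data.Vec using (Vec; lookup; _∷_; [])
open import Relation.Binary.PropositionalEquality using (refl; cong; cong₂)

-- A morphism of 𝔹(X × Y) is (x ≤ x' , t ≤ x' ⊖ x) paired componentwise;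
-- regrouping the pairs is already functorial on the nose, because order,
-- difference and hence ⊕ of the product are computed componentwise.

module _ {c ℓ} (X Y : DPoset c ℓ) where

  𝔹-split : IdObFunctor (𝔹 (X ×D Y)) (𝔹 X ×C 𝔹 Y)
  𝔹-split = record
    { F₁     = λ { ((p , q) , (s , t) , (u , v)) → (p , s , u) , (q , t , v) }
    ; F-resp = λ s≡t → cong proj₁ s≡t , cong proj₂ s≡t
    ; F-id   = refl , refl
    ; F-∘    = λ _ _ → refl , refl
    }

  𝔹-pair : IdObFunctor (𝔹 X ×C 𝔹 Y) (𝔹 (X ×D Y))
  𝔹-pair = record
    { F₁     = λ { ((p , s , u) , (q , t , v)) → (p , q) , (s , t) , (u , v) }
    ; F-resp = λ { (s₁≡t₁ , s₂≡t₂) → cong₂ _,_ s₁≡t₁ s₂≡t₂ }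
    ; F-id   = refl
    ; F-∘    = λ _ _ → refl
    }

  𝔹-×D-iso : IdObIso (𝔹 (X ×D Y)) (𝔹 X ×C 𝔹 Y)
  𝔹-×D-iso = record
    { to      = 𝔹-split
    ; from    = 𝔹-pair
    ; from∘to = λ _ → refl
    ; to∘from = λ _ → refl , refl
    }

𝔹₁-×M-coincides : ∀ {c ℓ} {X₁ X₂ X₃ X₄ : DPoset c ℓ}
                  (f₁ : DMono X₁ X₃) (f₂ : DMono X₂ X₄) →
                  Coincide f₁ f₂ (𝔹-×D-iso X₁ X₂) (𝔹-×D-iso X₃ X₄)
𝔹₁-×M-coincides f₁ f₂ h = refl , refl

mainTheorem4 : ∀ {c ℓ} (X₁ X₂ X₃ X₄ : DPoset c ℓ)
    (f₁ : DMono X₁ X₃) (f₂ : DMono X₂ X₄) →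
    Σ ((i j : Fin 4) →
    IdObIso (𝔹 (lookup (X₁ ∷ X₂ ∷ X₃ ∷ X₄ ∷ []) i ×D lookup (X₁ ∷ X₂ ∷ X₃ ∷ X₄ ∷ []) j))
    (𝔹 (lookup (X₁ ∷ X₂ ∷ X₃ ∷ X₄ ∷ []) i) ×C 𝔹 (lookup (X₁ ∷ X₂ ∷ X₃ ∷ X₄ ∷ []) j)))
    (λ Φ → Coincide f₁ f₂ (Φ Fin.zero (Fin.suc Fin.zero))
    (Φ (Fin.suc (Fin.suc Fin.zero)) (Fin.suc (Fin.suc (Fin.suc Fin.zero)))))
mainTheorem4 {c} {ℓ} X₁ X₂ X₃ X₄ f₁ f₂ =
  (λ i j → 𝔹-×D-iso (lookup Xs i) (lookup Xs j)) , 𝔹₁-×M-coincides f₁ f₂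
  where
  Xs : Vec (DPoset c ℓ) 4
  Xs = X₁ ∷ X₂ ∷ X₃ ∷ X₄ ∷ []
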